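{- Let $G$ be an ordered abelian group, $m, n \geq 2$ integers and $a \in G$. Then: (1) $\mathfrak{s}_n(a) \leq \mathfrak{s}_{mn}(a)$; (2) $\mathfrak{s}_n(a) = \mathfrak{s}_{mn}(ma)$; (3) if $m$ and $n$ are coprime, then $\mathfrak{s}_n(ma) = \mathfrak{s}_n(a)$; (4) $\mathfrak{t}_n(ma) = \mathfrak{t}_n(a)$.
   Context: Convex subgroups of $G$ are linearly ordered by inclusion, with $\emptyset$ considered smaller than every convex subgroup. For $n\ge2$, $a\in G$: if $a\notin nG$, $\mathfrak{s}_n(a)$ is the largest convex subgroup $H$ of $G$ with $a\notin H+nG$; if $a \in nG$, $\mathfrak{s}_n(a)=\emptyset$. $\mathcal{S}_n=\{\mathfrak{s}_n(a)\mid a\in G\}$ and $\mathfrak{t}_n(a)=\bigcup_{H\in\mathcal{S}_n,\, a\notin H}H$. -}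

module Defs where

open import Level using (Level; _⊔_; suc)
open import Data.Nat using (ℕ; zero) renaming (suc to sucℕ)
open import Data.Product using (Σ; ∃; _×_; _,_)
open import Relation.Nullary using (¬_)
open import Relation.Unary using (Pred)
open import Relation.Binary using (Rel; IsTotalOrder)
open import Algebra.Bundles using (AbelianGroup)

record OrderedAbelianGroup (c ℓ : Level) : Set (Level.suc (c ⊔ ℓ)) where
  field
    abelianGroup : AbelianGroup c ℓ
  open AbelianGroup abelianGroup public
  field
    _≤_          : Rel Carrier ℓ
    isTotalOrder : IsTotalOrder _≈_ _≤_
    ≤-compat     : ∀ {x y} z → x ≤ y → (x ∙ z) ≤ (y ∙ z)

module _ {c ℓ : Level} (G : OrderedAbelianGroup c ℓ) where
  open OrderedAbelianGroup G

  mul : ℕ → Carrier → Carrier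
  mul zero    x = ε
  mul (sucℕ k) x = x ∙ mul k x

  Subset : Set (Level.suc (c ⊔ ℓ))
  Subset = Pred Carrier (c ⊔ ℓ)

  record IsConvexSubgroup (H : Subset) : Set (c ⊔ ℓ) where
    field
      resp    : ∀ {x y} → x ≈ y → H x → H y
      has-ε   : H ε
      ∙-closed : ∀ {x y} → H x → H y → H (x ∙ y)
      ⁻¹-closed : ∀ {x} → H x → H (x ⁻¹)
      convex  : ∀ {x y z} → H x → H z → x ≤ y → y ≤ z → H y

  InMultiples : ℕ → Pred Carrier (c ⊔ ℓ)
  InMultiples n x = ∃ λ g → x ≈ mul n g

  InSumMultiples : Subset → ℕ → Pred Carrier (c ⊔ ℓ)
  InSumMultiples H n x = Σ Carrier λ h → Σ Carrier λ g → H h × (x ≈ (h ∙ mul n g))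

  -- 𝔰ₙ(a): the largest convex subgroup H with a ∉ H + nG, realised as the union of
  -- all such convex subgroups; it is empty (∅) exactly when a ∈ nG.
  𝔰 : ℕ → Carrier → Pred Carrier (Level.suc (c ⊔ ℓ))
  𝔰 n a x = Σ Subset λ H → IsConvexSubgroup H × ¬ InSumMultiples H n a × H x

  -- 𝔱ₙ(a) = ⋃ { H ∈ 𝒮ₙ | a ∉ H },  where 𝒮ₙ = { 𝔰ₙ(b) | b ∈ G }
  𝔱 : ℕ → Carrier → Pred Carrier (Level.suc (c ⊔ ℓ))
  𝔱 n a x = Σ Carrier λ b → ¬ 𝔰 n b a × 𝔰 n b x

-- Everything reduces to how a ∈ H + nG behaves for a single convex subgroup H, since 𝔰ₙ(a) is
-- the union of the convex subgroups H with a ∉ H + nG. Such an H is pure (G/H is torsion-free,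
-- because y lies between 0 and k·y for k ≥ 1), which gives m·a ∈ H + mnG ⇔ a ∈ H + nG.
-- H + nG is a subgroup, and for m coprime to n Bézout writes a as an integer combination of
-- m·a and an element of nG. Part (4) holds because every 𝔰ₙ(b) is a union of pure subgroups,
-- hence contains m·x exactly when it contains x.
module Submission where

open import Defs
open import Level using (Level)
open import Data.Nat using (ℕ; _≤_; _*_)
open import Data.Nat.Coprimality using (Coprime)
open import Data.Product using (_×_)
open import Relation.Unary using (_⊆_; _≐_)

open import Data.Nat using (zero; suc; s≤s)
open import Data.Nat.Properties using (*-comm)
open import Data.Nat.Coprimality using (coprime-Bézout)
open import Data.Nat.GCD using (module Bézout)
open import Data.Product using (_,_)
open import Data.Sum using (inj₁; inj₂)
open import Function using (_∘_)
open import Relation.Binary using (IsTotalOrder)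
import Relation.Binary.PropositionalEquality as ≡
import Relation.Binary.Reasoning.Setoid as SetoidReasoning
import Algebra.Properties.AbelianGroup as AbelianGroupProperties
import Algebra.Properties.CommutativeMonoid.Mult as MultProperties
import Algebra.Properties.CommutativeSemigroup as CommutativeSemigroupProperties

module _ {c ℓ : Level} (G : OrderedAbelianGroup c ℓ) where
  open OrderedAbelianGroup G renaming (_≤_ to _≤ᴳ_)
  open AbelianGroupProperties abelianGroup
    using (inverseʳ-unique; ⁻¹-∙-comm; //-rightDividesˡ; //-rightDividesʳ)
  open CommutativeSemigroupProperties commutativeSemigroup using (interchange)
  open MultProperties commutativeMonoid using (×-congʳ; ×-assocˡ; ×-distrib-+)
    renaming (_×_ to _×ᴳ_)
  open IsTotalOrder isTotalOrder using (total) renaming (reflexive to ≤-reflexive; trans to ≤-trans)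
  open SetoidReasoning setoid

  mul≡× : ∀ k x → mul G k x ≡.≡ k ×ᴳ x
  mul≡× zero    x = ≡.refl
  mul≡× (suc k) x = ≡.cong (x ∙_) (mul≡× k x)

  mul-congʳ : ∀ k {x y} → x ≈ y → mul G k x ≈ mul G k y
  mul-congʳ k {x} {y} x≈y rewrite mul≡× k x | mul≡× k y = ×-congʳ k x≈y

  mul-assoc : ∀ m n x → mul G m (mul G n x) ≈ mul G (m * n) x
  mul-assoc m n x rewrite mul≡× n x | mul≡× m (n ×ᴳ x) | mul≡× (m * n) x = ×-assocˡ x m n

  mul-assoc-comm : ∀ m n x → mul G m (mul G n x) ≈ mul G (n * m) x
  mul-assoc-comm m n x = trans (mul-assoc m n x) (reflexive (≡.cong (λ k → mul G k x) (*-comm m n)))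

  mul-distrib-∙ : ∀ k x y → mul G k (x ∙ y) ≈ mul G k x ∙ mul G k y
  mul-distrib-∙ k x y rewrite mul≡× k (x ∙ y) | mul≡× k x | mul≡× k y = ×-distrib-+ x y k

  mul-ε : ∀ k → mul G k ε ≈ ε
  mul-ε zero    = refl
  mul-ε (suc k) = trans (identityˡ _) (mul-ε k)

  mul-⁻¹ : ∀ k x → mul G k (x ⁻¹) ≈ (mul G k x) ⁻¹
  mul-⁻¹ k x = inverseʳ-unique (mul G k x) (mul G k (x ⁻¹)) (begin
    mul G k x ∙ mul G k (x ⁻¹) ≈⟨ mul-distrib-∙ k x (x ⁻¹) ⟨
    mul G k (x ∙ x ⁻¹)         ≈⟨ mul-congʳ k (inverseʳ x) ⟩
    mul G k ε                  ≈⟨ mul-ε k ⟩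
    ε                          ∎)

  ≤-compatˡ : ∀ {x y} z → x ≤ᴳ y → (z ∙ x) ≤ᴳ (z ∙ y)
  ≤-compatˡ z x≤y =
    ≤-trans (≤-reflexive (comm _ _)) (≤-trans (≤-compat z x≤y) (≤-reflexive (comm _ _)))

  ∙-mono-≤ : ∀ {x x′ y y′} → x ≤ᴳ x′ → y ≤ᴳ y′ → (x ∙ y) ≤ᴳ (x′ ∙ y′)
  ∙-mono-≤ {y = y} x≤x′ y≤y′ = ≤-trans (≤-compat y x≤x′) (≤-compatˡ _ y≤y′)

  mul-mono-≤ : ∀ k {x y} → x ≤ᴳ y → mul G k x ≤ᴳ mul G k y
  mul-mono-≤ zero    _   = ≤-reflexive refl
  mul-mono-≤ (suc k) x≤y = ∙-mono-≤ x≤y (mul-mono-≤ k x≤y)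

  ε≤mul : ∀ k {y} → ε ≤ᴳ y → ε ≤ᴳ mul G k y
  ε≤mul k ε≤y = ≤-trans (≤-reflexive (sym (mul-ε k))) (mul-mono-≤ k ε≤y)

  mul≤ε : ∀ k {y} → y ≤ᴳ ε → mul G k y ≤ᴳ ε
  mul≤ε k y≤ε = ≤-trans (mul-mono-≤ k y≤ε) (≤-reflexive (mul-ε k))

  x≤x∙y : ∀ x {y} → ε ≤ᴳ y → x ≤ᴳ (x ∙ y)
  x≤x∙y x ε≤y = ≤-trans (≤-reflexive (sym (identityʳ x))) (≤-compatˡ x ε≤y)

  x∙y≤x : ∀ x {y} → y ≤ᴳ ε → (x ∙ y) ≤ᴳ x
  x∙y≤x x y≤ε = ≤-trans (≤-compatˡ x y≤ε) (≤-reflexive (identityʳ x))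

  ∈H+mnG⇒∈H+nG : ∀ {H} m n {a} → InSumMultiples G H (m * n) a → InSumMultiples G H n a
  ∈H+mnG⇒∈H+nG m n (h , g , Hh , a≈h+mng) =
    h , mul G m g , Hh , trans a≈h+mng (∙-congˡ (sym (mul-assoc-comm n m g)))

  module _ {H : Subset G} (H-convex : IsConvexSubgroup G H) where
    open IsConvexSubgroup H-convex

    mul-closed : ∀ k {x} → H x → H (mul G k x)
    mul-closed zero    _  = has-ε
    mul-closed (suc k) Hx = ∙-closed Hx (mul-closed k Hx)

    convex⇒pure : ∀ k {y} → H (mul G (suc k) y) → H y
    convex⇒pure k {y} H[1+k]y with total ε y
    ... | inj₁ ε≤y = convex has-ε H[1+k]y ε≤y (x≤x∙y y (ε≤mul k ε≤y))
    ... | inj₂ y≤ε = convex H[1+k]y has-ε (x∙y≤x y (mul≤ε k y≤ε)) y≤ε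

    ∈H+nG⇒m∈H+mnG : ∀ m n {a} → InSumMultiples G H n a → InSumMultiples G H (m * n) (mul G m a)
    ∈H+nG⇒m∈H+mnG m n {a} (h , g , Hh , a≈h+ng) = mul G m h , g , mul-closed m Hh , (begin
      mul G m a                       ≈⟨ mul-congʳ m a≈h+ng ⟩
      mul G m (h ∙ mul G n g)         ≈⟨ mul-distrib-∙ m h _ ⟩
      mul G m h ∙ mul G m (mul G n g) ≈⟨ ∙-congˡ (mul-assoc m n g) ⟩
      mul G m h ∙ mul G (m * n) g     ∎)

    ∈H+nG⇒m∈H+nG : ∀ m n {a} → InSumMultiples G H n a → InSumMultiples G H n (mul G m a)
    ∈H+nG⇒m∈H+nG m n = ∈H+mnG⇒∈H+nG m n ∘ ∈H+nG⇒m∈H+mnG m n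

    m∈H+mnG⇒∈H+nG : ∀ k n {a} →
      InSumMultiples G H (suc k * n) (mul G (suc k) a) → InSumMultiples G H n a
    m∈H+mnG⇒∈H+nG k n {a} (h , g , Hh , ma≈h+mng) =
      a - mul G n g , g , convex⇒pure k (resp (sym m[a-ng]≈h) Hh) , sym (//-rightDividesˡ _ a)
      where
      m = suc k
      m[a-ng]≈h : mul G m (a - mul G n g) ≈ h
      m[a-ng]≈h = begin
        mul G m (a - mul G n g)                    ≈⟨ mul-distrib-∙ m a _ ⟩
        mul G m a ∙ mul G m (mul G n g ⁻¹)         ≈⟨ ∙-congˡ (mul-⁻¹ m _) ⟩
        mul G m a - mul G m (mul G n g)            ≈⟨ ∙-cong ma≈h+mng (⁻¹-cong (mul-assoc m n g)) ⟩
        (h ∙ mul G (m * n) g) - mul G (m * n) g    ≈⟨ //-rightDividesʳ _ h ⟩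
        h                                          ∎

    module _ (n : ℕ) where
      H+nG-resp : ∀ {x y} → x ≈ y → InSumMultiples G H n x → InSumMultiples G H n y
      H+nG-resp x≈y (h , g , Hh , x≈h+ng) = h , g , Hh , trans (sym x≈y) x≈h+ng

      H+nG-−-closed : ∀ {x y} →
        InSumMultiples G H n x → InSumMultiples G H n y → InSumMultiples G H n (x - y)
      H+nG-−-closed {x} {y} (h , g , Hh , x≈h+ng) (h′ , g′ , Hh′ , y≈h′+ng′) =
        h - h′ , g - g′ , ∙-closed Hh (⁻¹-closed Hh′) , (begin
          x - y                                           ≈⟨ ∙-cong x≈h+ng (⁻¹-cong y≈h′+ng′) ⟩
          (h ∙ mul G n g) ∙ (h′ ∙ mul G n g′) ⁻¹          ≈⟨ ∙-congˡ (⁻¹-∙-comm h′ _) ⟨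
          (h ∙ mul G n g) ∙ (h′ ⁻¹ ∙ mul G n g′ ⁻¹)       ≈⟨ interchange h _ _ _ ⟩
          (h - h′) ∙ (mul G n g - mul G n g′)             ≈⟨ ∙-congˡ (∙-congˡ (mul-⁻¹ n g′)) ⟨
          (h - h′) ∙ (mul G n g ∙ mul G n (g′ ⁻¹))        ≈⟨ ∙-congˡ (mul-distrib-∙ n g _) ⟨
          (h - h′) ∙ mul G n (g - g′)                     ∎)

      nG⊆H+nG : ∀ g → InSumMultiples G H n (mul G n g)
      nG⊆H+nG g = ε , g , has-ε , sym (identityˡ _)

      -- a = (1 + k)·a − k·a
      consecutive-multiples⇒∈H+nG : ∀ k {a} → InSumMultiples G H n (mul G k a) →
        InSumMultiples G H n (mul G (suc k) a) → InSumMultiples G H n a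
      consecutive-multiples⇒∈H+nG k {a} ka∈ [1+k]a∈ =
        H+nG-resp (//-rightDividesʳ (mul G k a) a) (H+nG-−-closed [1+k]a∈ ka∈)

      m∈H+nG⇒∈H+nG : ∀ m {a} →
        Coprime m n → InSumMultiples G H n (mul G m a) → InSumMultiples G H n a
      m∈H+nG⇒∈H+nG m {a} m⊥n ma∈ = fromBézout (coprime-Bézout m⊥n)
        where
        xm∈ : ∀ x → InSumMultiples G H n (mul G (x * m) a)
        xm∈ x = H+nG-resp (mul-assoc x m a) (∈H+nG⇒m∈H+nG x n ma∈)

        yn∈ : ∀ y → InSumMultiples G H n (mul G (y * n) a)
        yn∈ y = H+nG-resp (mul-assoc-comm n y a) (nG⊆H+nG (mul G y a))

        resp-≡ : ∀ {i j} → suc i ≡.≡ j →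
          InSumMultiples G H n (mul G j a) → InSumMultiples G H n (mul G (suc i) a)
        resp-≡ 1+i≡j = ≡.subst (λ k → InSumMultiples G H n (mul G k a)) (≡.sym 1+i≡j)

        fromBézout : Bézout.Identity 1 m n → InSumMultiples G H n a
        fromBézout (Bézout.+- x y 1+yn≡xm) =
          consecutive-multiples⇒∈H+nG (y * n) (yn∈ y) (resp-≡ 1+yn≡xm (xm∈ x))
        fromBézout (Bézout.-+ x y 1+xm≡yn) =
          consecutive-multiples⇒∈H+nG (x * m) (xm∈ x) (resp-≡ 1+xm≡yn (yn∈ y))

  𝔰⊆𝔰 : ∀ n a n′ a′ →
    (∀ {H} → IsConvexSubgroup G H → InSumMultiples G H n′ a′ → InSumMultiples G H n a) →
    𝔰 G n a ⊆ 𝔰 G n′ a′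
  𝔰⊆𝔰 _ _ _ _ reflect (H , H-convex , a∉H+nG , Hx) =
    H , H-convex , a∉H+nG ∘ reflect H-convex , Hx

  𝔰-mul-closed : ∀ k n b {x} → 𝔰 G n b x → 𝔰 G n b (mul G k x)
  𝔰-mul-closed k n b (H , H-convex , b∉H+nG , Hx) =
    H , H-convex , b∉H+nG , mul-closed H-convex k Hx

  𝔰-pure : ∀ k n b {x} → 𝔰 G n b (mul G (suc k) x) → 𝔰 G n b x
  𝔰-pure k n b (H , H-convex , b∉H+nG , H[1+k]x) =
    H , H-convex , b∉H+nG , convex⇒pure H-convex k H[1+k]x

  𝔱-mul : ∀ k n a → 𝔱 G n (mul G (suc k) a) ≐ 𝔱 G n a
  𝔱-mul k n a =
    (λ (b , ma∉𝔰b , x∈𝔰b) → b , ma∉𝔰b ∘ 𝔰-mul-closed (suc k) n b , x∈𝔰b) ,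
    (λ (b , a∉𝔰b , x∈𝔰b) → b , a∉𝔰b ∘ 𝔰-pure k n b , x∈𝔰b)

lemma2p8 : ∀ {c ℓ : Level} (G : OrderedAbelianGroup c ℓ) (m n : ℕ) → 2 ≤ m → 2 ≤ n →
    (a : OrderedAbelianGroup.Carrier G) →
    (𝔰 G n a ⊆ 𝔰 G (m * n) a)
    × (𝔰 G n a ≐ 𝔰 G (m * n) (mul G m a))
    × (Coprime m n → 𝔰 G n (mul G m a) ≐ 𝔰 G n a)
    × (𝔱 G n (mul G m a) ≐ 𝔱 G n a)
lemma2p8 G m@(suc k) n (s≤s _) _ a =
  𝔰⊆𝔰 G n a (m * n) a (λ _ → ∈H+mnG⇒∈H+nG G m n) ,
  ( 𝔰⊆𝔰 G n a (m * n) ma (λ H-convex → m∈H+mnG⇒∈H+nG G H-convex k n)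
  , 𝔰⊆𝔰 G (m * n) ma n a (λ H-convex → ∈H+nG⇒m∈H+mnG G H-convex m n)) ,
  (λ m⊥n →
    𝔰⊆𝔰 G n ma n a (λ H-convex → ∈H+nG⇒m∈H+nG G H-convex m n) ,
    𝔰⊆𝔰 G n a n ma (λ H-convex → m∈H+nG⇒∈H+nG G H-convex n m m⊥n)) ,
  𝔱-mul G k n a
  where ma = mul G m a
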